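{- Let $G=(V,E)$ be a loopless strongly connected graph, and let $\$$ be a simple vertex of $G$, used as bank vertex. Then every coevalence class of critical configurations on $(G,\$)$ is a singleton.
   Context: A graph is a finite directed multigraph. $A$ is the $V\times V$ matrix with $A_{vw}$ the number of directed edges from $v$ to $w$, $\Delta$ is diagonal with $\Delta_{vv}=\sum_wA_{vw}$, $Q=\Delta-A$, $\dagger$ denotes transpose, $\hat v$ is the characteristic vector of $v$. The activity vector $\mathbf{h}$ of strongly connected $G$ is the unique vector with positive integer entries, gcd of entries $1$, and $Q^{\dagger}\mathbf{h}=\mathbf{0}$; $v$ is simple if $h(v)=1$. A configuration is $\mathbf{c}\in\mathbf{Z}^V$ with $\sum_vc(v)=0$. A vertex $v\ne\$$ is legal for $\mathbf{c}$ if $c(v)\ge\Delta_{vv}$; $\mathbf{c}$ is stable if $c(v)<\Delta_{vv}$ for all $v\ne\$$. Firing gives $\mathbf{c}|v:=\mathbf{c}-Q^{\dagger}\hat v$; a sequence $v_1\cdots v_k$ is legal for $\mathbf{c}$ if each $v_i$ is legal for $\mathbf{c}|v_1\cdots v_{i-1}$. $\mathcal{S}(\mathbf{c})$ is the set of $\mathbf{c}|v_1\cdots v_k$ over legal sequences (possibly empty) not containing $\$$; it contains a unique stable configuration, the stabilization of $\mathbf{c}$. For stable $\mathbf{c}$, the successor $\sigma(\mathbf{c})$ is the stabilization of $\mathbf{c}|\$$. A stable $\mathbf{c}$ is critical if $\sigma^k(\mathbf{c})=\mathbf{c}$ for some $k\ge1$. Critical $\mathbf{a},\mathbf{b}$ are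 coeval if $\sigma^m(\mathbf{a})=\mathbf{b}$ for some $m\ge0$ (an equivalence relation on critical configurations). -}

module Defs where

open import Data.Nat as ℕ using (ℕ; zero; suc)
open import Data.Nat.GCD using (gcd)
open import Data.Integer as ℤ using (ℤ; +_; _-_)
open import Data.Fin using (Fin; zero; suc)
open import Data.Fin.Properties using () renaming (_≟_ to _≟ᶠ_)
open import Data.List using (List; foldr; map)
open import Data.List using () renaming (allFin to allFinL)
open import Data.Product using (Σ; ∃; _×_)
open import Relation.Binary.PropositionalEquality using (_≡_; _≢_)
open import Relation.Nullary using (yes; no)

-- A directed multigraph on vertex set Fin n, given by its adjacency matrix:
-- A v w = number of directed edges from v to w.
Graph : ℕ → Set
Graph n = Fin n → Fin n → ℕ

Σℤ : ∀ {n} → (Fin n → ℤ) → ℤ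
Σℤ {zero}  f = + 0
Σℤ {suc n} f = f zero ℤ.+ Σℤ {n} (λ i → f (suc i))

Σℕ : ∀ {n} → (Fin n → ℕ) → ℕ
Σℕ {zero}  f = 0
Σℕ {suc n} f = f zero ℕ.+ Σℕ {n} (λ i → f (suc i))

module _ {n : ℕ} (A : Graph n) where

  Δ : Fin n → ℕ
  Δ v = Σℕ (λ w → A v w)

  Q : Fin n → Fin n → ℤ
  Q v w with v ≟ᶠ w
  ... | yes _ = + Δ v - + A v w
  ... | no  _ = + 0 - + A v w

  Loopless : Set
  Loopless = ∀ v → A v v ≡ 0

  data Reach : Fin n → Fin n → Set where
    here : ∀ {v} → Reach v v
    step : ∀ {u v w} → A u v ≢ 0 → Reach v w → Reach u w

  StronglyConnected : Set
  StronglyConnected = ∀ u v → Reach u v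

  QTapply : (Fin n → ℕ) → Fin n → ℤ
  QTapply h w = Σℤ (λ v → Q v w ℤ.* + h v)

  IsActivity : (Fin n → ℕ) → Set
  IsActivity h =
    (∀ v → 1 ℕ.≤ h v) ×
    (foldr gcd 0 (map h (allFinL n)) ≡ 1) ×
    (∀ w → QTapply h w ≡ + 0)

  Config : Set
  Config = Fin n → ℤ

  IsConfiguration : Config → Set
  IsConfiguration c = Σℤ c ≡ + 0

  fire : Config → Fin n → Config
  fire c v w = c w - Q v w

  module _ (bank : Fin n) where

    Legal : Config → Fin n → Set
    Legal c v = v ≢ bank × (+ Δ v ℤ.≤ c v)

    Stable : Config → Set
    Stable c = ∀ v → v ≢ bank → c v ℤ.< + Δ v

    data LegalSeq : Config → Config → Set where
      done : ∀ {c d} → (∀ w → c w ≡ d w) → LegalSeq c d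
      fire-step : ∀ {c d} v → Legal c v → LegalSeq (fire c v) d → LegalSeq c d

    IsStabilization : Config → Config → Set
    IsStabilization c s = LegalSeq c s × Stable s

    Successor : Config → Config → Set
    Successor c d = Stable c × IsStabilization (fire c bank) d

    Iter : ℕ → Config → Config → Set
    Iter zero    c d = ∀ w → c w ≡ d w
    Iter (suc k) c d = ∃ λ e → Successor c e × Iter k e d

    Critical : Config → Set
    Critical c = Stable c × ∃ λ k → Iter (suc k) c c

    Coeval : Config → Config → Set
    Coeval a b = ∃ λ m → Iter m a b

{-# OPTIONS --safe #-}
-- Write a ⊖ x for a − Q†x, the configuration reached from a by firing each vertex v x(v) times.
-- By the least action principle the firing vector of a stabilisation is the least vector above the
-- starting one that yields a stable configuration. As a ⊖ h = a and h($) = 1, a successor step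
-- from a stable configuration therefore fires at most h. Around a cycle a → σ(a) → ⋯ → a of length
-- k + 1 the total firing vector y thus satisfies y ≤ (k + 1)h, y($) = k + 1 and Q†y = 0. Since Q is
-- a Z-matrix and G is strongly connected, a nonnegative vector in ker Q† vanishing at one vertex
-- vanishes everywhere, so y = (k + 1)h: the first step fires exactly h and σ(a) = a. Successors
-- being unique, everything coeval with a equals a.
module Submission where

open import Defs
open import Data.Nat using (ℕ)
open import Data.Integer using (ℤ; +_)
open import Data.Fin using (Fin)
open import Relation.Binary.PropositionalEquality using (_≡_)

open import Data.Nat as ℕ using (zero; suc; z≤n)
import Data.Nat.Properties as ℕP
open import Data.Integer as ℤ using (_-_; -[1+_])
import Data.Integer.Properties as ℤP
open import Data.Integer.Tactic.RingSolver using (solve-∀)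
open import Data.Fin using (zero; suc)
open import Data.Fin.Properties using (punchInᵢ≢i) renaming (_≟_ to _≟ᶠ_)
open import Data.Vec.Functional using (removeAt)
open import Data.Product using (∃; _×_; _,_; proj₁; proj₂)
open import Data.Sum using (inj₁; inj₂)
open import Data.Empty using (⊥-elim)
open import Function using (_∘_)
open import Relation.Binary.PropositionalEquality
  using (refl; sym; trans; cong; cong₂; subst; _≢_; _≗_; module ≡-Reasoning)
open import Relation.Nullary using (Dec; yes; no)
open import Algebra.Properties.Semiring.Sum ℤP.+-*-semiring
  using (sum; sum-cong-≗; sum-remove; ∑-distrib-+; sum-replicate-zero)
open import Algebra.Properties.AbelianGroup ℤP.+-0-abelianGroup using (identityʳ-unique)

Σℤ≡sum : ∀ {n} (f : Fin n → ℤ) → Σℤ f ≡ sum f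
Σℤ≡sum {zero}  f = refl
Σℤ≡sum {suc n} f = cong (ℤ._+_ (f zero)) (Σℤ≡sum (f ∘ suc))

sum-zero : ∀ {n} {t : Fin n → ℤ} → (∀ i → t i ≡ + 0) → sum t ≡ + 0
sum-zero {n} t≗0 = trans (sum-cong-≗ t≗0) (sum-replicate-zero n)

sum-nonpos : ∀ {n} {t : Fin n → ℤ} → (∀ i → t i ℤ.≤ + 0) → sum t ℤ.≤ + 0
sum-nonpos {zero}  _   = ℤP.≤-refl
sum-nonpos {suc n} t≤0 = ℤP.+-mono-≤ (t≤0 zero) (sum-nonpos (t≤0 ∘ suc))

sum-≤-term : ∀ {n} (t : Fin n → ℤ) i → (∀ j → j ≢ i → t j ℤ.≤ + 0) → sum t ℤ.≤ t i
sum-≤-term {suc n} t i others≤0 = begin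
  sum t                      ≡⟨ sum-remove {i = i} t ⟩
  t i ℤ.+ sum (removeAt t i) ≤⟨ ℤP.+-monoʳ-≤ (t i) rest≤0 ⟩
  t i ℤ.+ + 0                ≡⟨ ℤP.+-identityʳ (t i) ⟩
  t i                        ∎
  where
  open ℤP.≤-Reasoning
  rest≤0 : sum (removeAt t i) ℤ.≤ + 0
  rest≤0 = sum-nonpos (λ j → others≤0 _ (punchInᵢ≢i i j))

sum-≡-term : ∀ {n} (t : Fin n → ℤ) i → (∀ j → j ≢ i → t j ≡ + 0) → sum t ≡ t i
sum-≡-term {suc n} t i others≡0 = begin
  sum t                      ≡⟨ sum-remove {i = i} t ⟩
  t i ℤ.+ sum (removeAt t i) ≡⟨ cong (ℤ._+_ (t i)) rest≡0 ⟩
  t i ℤ.+ + 0                ≡⟨ ℤP.+-identityʳ (t i) ⟩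
  t i                        ∎
  where
  open ≡-Reasoning
  rest≡0 : sum (removeAt t i) ≡ + 0
  rest≡0 = sum-zero (λ j → others≡0 _ (punchInᵢ≢i i j))

0-m*n≤0 : ∀ m n → (+ 0 - + m) ℤ.* + n ℤ.≤ + 0
0-m*n≤0 zero    n       = ℤP.≤-refl
0-m*n≤0 (suc m) zero    = ℤP.≤-reflexive (ℤP.*-zeroʳ -[1+ m ])
0-m*n≤0 (suc m) (suc n) = ℤ.-≤+

0-m*n<0 : ∀ {m n} → m ≢ 0 → n ≢ 0 → (+ 0 - + m) ℤ.* + n ℤ.< + 0
0-m*n<0 {zero}  {n}     m≢0 _   = ⊥-elim (m≢0 refl)
0-m*n<0 {suc m} {zero}  _   n≢0 = ⊥-elim (n≢0 refl)
0-m*n<0 {suc m} {suc n} _   _   = ℤ.-<+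

i-j≡i⇒j≡0 : ∀ i j → i - j ≡ i → j ≡ + 0
i-j≡i⇒j≡0 i j eq =
  trans (sym (ℤP.neg-involutive j)) (cong ℤ.-_ (identityʳ-unique i (ℤ.- j) eq))

FiringVector : ℕ → Set
FiringVector n = Fin n → ℕ

module _ {n : ℕ} where

  infixl 6 _+ᵛ_ _∸ᵛ_
  infixl 7 _*ᵛ_
  infix  4 _≤ᵛ_

  _+ᵛ_ : FiringVector n → FiringVector n → FiringVector n
  (x +ᵛ y) i = x i ℕ.+ y i

  _∸ᵛ_ : FiringVector n → FiringVector n → FiringVector n
  (x ∸ᵛ y) i = x i ℕ.∸ y i

  _*ᵛ_ : ℕ → FiringVector n → FiringVector n
  (m *ᵛ x) i = m ℕ.* x i

  _≤ᵛ_ : FiringVector n → FiringVector n → Set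
  x ≤ᵛ y = ∀ i → x i ℕ.≤ y i

  0ᵛ : FiringVector n
  0ᵛ _ = 0

  χ : Fin n → FiringVector n
  χ v i with i ≟ᶠ v
  ... | yes _ = 1
  ... | no  _ = 0

  χ-same : ∀ v → χ v v ≡ 1
  χ-same v with v ≟ᶠ v
  ... | yes _   = refl
  ... | no  v≢v = ⊥-elim (v≢v refl)

  χ-other : ∀ {v i} → i ≢ v → χ v i ≡ 0
  χ-other {v} {i} i≢v with i ≟ᶠ v
  ... | yes i≡v = ⊥-elim (i≢v i≡v)
  ... | no  _   = refl

  χ-≤ : ∀ {x} v → 1 ℕ.≤ x v → χ v ≤ᵛ x
  χ-≤ v 1≤xv i with i ≟ᶠ v
  ... | yes refl = 1≤xv
  ... | no  _    = z≤n

  +χ-≤ : ∀ {x y} v → x ≤ᵛ y → x v ℕ.< y v → x +ᵛ χ v ≤ᵛ y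
  +χ-≤ {x} {y} v x≤y xv<yv i with i ≟ᶠ v
  ... | yes refl = subst (ℕ._≤ y i) (ℕP.+-comm 1 (x i)) xv<yv
  ... | no  _    = subst (ℕ._≤ y i) (sym (ℕP.+-identityʳ (x i))) (x≤y i)

  +ᵛ-∸ᵛ : ∀ {x y} → x ≤ᵛ y → y ≗ x +ᵛ (y ∸ᵛ x)
  +ᵛ-∸ᵛ x≤y i = sym (ℕP.m+[n∸m]≡n (x≤y i))

  ∸ᵛ-≡0 : ∀ x y {v} → x v ≡ y v → (y ∸ᵛ x) v ≡ 0
  ∸ᵛ-≡0 x y {v} xv≡yv = trans (cong (y v ℕ.∸_) xv≡yv) (ℕP.n∸n≡0 (y v))

module _ {n : ℕ} (A : Graph n) where

  Q† : FiringVector n → Fin n → ℤ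
  Q† x w = sum (λ v → Q A v w ℤ.* + x v)

  QTapply≡Q† : ∀ x w → QTapply A x w ≡ Q† x w
  QTapply≡Q† x w = Σℤ≡sum (λ v → Q A v w ℤ.* + x v)

  Q†-cong : ∀ {x y} → x ≗ y → ∀ w → Q† x w ≡ Q† y w
  Q†-cong x≗y w = sum-cong-≗ (λ v → cong (λ k → Q A v w ℤ.* + k) (x≗y v))

  Q†-+ : ∀ x y w → Q† (x +ᵛ y) w ≡ Q† x w ℤ.+ Q† y w
  Q†-+ x y w =
    trans (sum-cong-≗ distrib) (∑-distrib-+ (λ v → Q A v w ℤ.* + x v) (λ v → Q A v w ℤ.* + y v))
    where
    distrib : ∀ v → Q A v w ℤ.* + (x v ℕ.+ y v) ≡ Q A v w ℤ.* + x v ℤ.+ Q A v w ℤ.* + y v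
    distrib v =
      trans (cong (Q A v w ℤ.*_) (ℤP.pos-+ (x v) (y v))) (ℤP.*-distribˡ-+ (Q A v w) _ _)

  Q†-0 : ∀ w → Q† 0ᵛ w ≡ + 0
  Q†-0 w = sum-zero (λ v → ℤP.*-zeroʳ (Q A v w))

  Q†-χ : ∀ v w → Q† (χ v) w ≡ Q A v w
  Q†-χ v w = begin
    Q† (χ v) w               ≡⟨ sum-≡-term _ v (λ u u≢v → term-zero (χ-other u≢v)) ⟩
    Q A v w ℤ.* + χ v v      ≡⟨ cong (λ k → Q A v w ℤ.* + k) (χ-same v) ⟩
    Q A v w ℤ.* + 1          ≡⟨ ℤP.*-identityʳ (Q A v w) ⟩
    Q A v w                  ∎
    where
    open ≡-Reasoning
    term-zero : ∀ {u} → χ v u ≡ 0 → Q A u w ℤ.* + χ v u ≡ + 0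
    term-zero {u} eq = trans (cong (λ k → Q A u w ℤ.* + k) eq) (ℤP.*-zeroʳ (Q A u w))

  Q†-*ᵛ-kernel : ∀ {x} → (∀ w → Q† x w ≡ + 0) → ∀ m w → Q† (m *ᵛ x) w ≡ + 0
  Q†-*ᵛ-kernel ker zero    w = Q†-0 w
  Q†-*ᵛ-kernel ker (suc m) w =
    trans (Q†-+ _ (m *ᵛ _) w) (cong₂ ℤ._+_ (ker w) (Q†-*ᵛ-kernel ker m w))

  Q-off-diagonal : ∀ {u v} → u ≢ v → Q A u v ≡ + 0 - + A u v
  Q-off-diagonal {u} {v} u≢v with u ≟ᶠ v
  ... | yes u≡v = ⊥-elim (u≢v u≡v)
  ... | no  _   = refl

  -- Q is a Z-matrix: its off-diagonal entries are ≤ 0.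
  Q†-term-nonpos : ∀ {x : FiringVector n} {v} → x v ≡ 0 →
    ∀ u → Q A u v ℤ.* + x u ℤ.≤ + 0
  Q†-term-nonpos {x} {v} xv≡0 u = by-cases (u ≟ᶠ v)
    where
    by-cases : Dec (u ≡ v) → Q A u v ℤ.* + x u ℤ.≤ + 0
    by-cases (yes refl) =
      ℤP.≤-reflexive (trans (cong (λ k → Q A u u ℤ.* + k) xv≡0) (ℤP.*-zeroʳ (Q A u u)))
    by-cases (no u≢v)   =
      subst (λ q → q ℤ.* + x u ℤ.≤ + 0) (sym (Q-off-diagonal u≢v)) (0-m*n≤0 (A u v) (x u))

  Q†-antitone-where-equal : ∀ {x y v} → x ≤ᵛ y → x v ≡ y v → Q† y v ℤ.≤ Q† x v
  Q†-antitone-where-equal {x} {y} {v} x≤y xv≡yv = begin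
    Q† y v                        ≡⟨ Q†-cong (+ᵛ-∸ᵛ x≤y) v ⟩
    Q† (x +ᵛ (y ∸ᵛ x)) v          ≡⟨ Q†-+ x (y ∸ᵛ x) v ⟩
    Q† x v ℤ.+ Q† (y ∸ᵛ x) v      ≤⟨ ℤP.+-monoʳ-≤ (Q† x v) (sum-nonpos y∸x-terms-nonpos) ⟩
    Q† x v ℤ.+ + 0                ≡⟨ ℤP.+-identityʳ (Q† x v) ⟩
    Q† x v                        ∎
    where
    open ℤP.≤-Reasoning
    y∸x-terms-nonpos : ∀ u → Q A u v ℤ.* + (y ∸ᵛ x) u ℤ.≤ + 0
    y∸x-terms-nonpos = Q†-term-nonpos (∸ᵛ-≡0 x y xv≡yv)

  kernel-zero-along-edge : ∀ {x v w} → (∀ u → Q† x u ≡ + 0) → A v w ≢ 0 →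
    x w ≡ 0 → x v ≡ 0
  kernel-zero-along-edge {x} {v} {w} ker Avw≢0 xw≡0 with x v ℕ.≟ 0
  ... | yes xv≡0 = xv≡0
  ... | no  xv≢0 = ⊥-elim (ℤP.<-irrefl refl (ℤP.≤-<-trans 0≤term term<0))
    where
    v≢w : v ≢ w
    v≢w refl = xv≢0 xw≡0
    0≤term : + 0 ℤ.≤ Q A v w ℤ.* + x v
    0≤term = subst (ℤ._≤ Q A v w ℤ.* + x v) (ker w)
      (sum-≤-term _ v (λ u _ → Q†-term-nonpos {x = x} xw≡0 u))
    term<0 : Q A v w ℤ.* + x v ℤ.< + 0
    term<0 = subst (λ q → q ℤ.* + x v ℤ.< + 0) (sym (Q-off-diagonal v≢w)) (0-m*n<0 Avw≢0 xv≢0)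

  kernel-zero-propagates : ∀ {x v t} → (∀ u → Q† x u ≡ + 0) → Reach A v t →
    x t ≡ 0 → x v ≡ 0
  kernel-zero-propagates ker here           xt≡0 = xt≡0
  kernel-zero-propagates ker (step Avw≢0 r) xt≡0 =
    kernel-zero-along-edge ker Avw≢0 (kernel-zero-propagates ker r xt≡0)

  kernel-≤-rigid : StronglyConnected A → ∀ {x y t} → x ≤ᵛ y →
    (∀ w → Q† x w ≡ Q† y w) → x t ≡ y t → x ≗ y
  kernel-≤-rigid sc {x} {y} {t} x≤y Q†x≡Q†y xt≡yt v =
    ℕP.≤-antisym (x≤y v)
      (ℕP.m∸n≡0⇒m≤n (kernel-zero-propagates y∸x-kernel (sc v t) (∸ᵛ-≡0 x y xt≡yt)))
    where
    y∸x-kernel : ∀ w → Q† (y ∸ᵛ x) w ≡ + 0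
    y∸x-kernel w = identityʳ-unique (Q† x w) (Q† (y ∸ᵛ x) w) (begin
      Q† x w ℤ.+ Q† (y ∸ᵛ x) w   ≡⟨ Q†-+ x (y ∸ᵛ x) w ⟨
      Q† (x +ᵛ (y ∸ᵛ x)) w       ≡⟨ Q†-cong (+ᵛ-∸ᵛ x≤y) w ⟨
      Q† y w                     ≡⟨ Q†x≡Q†y w ⟨
      Q† x w                     ∎)
      where open ≡-Reasoning

module Firing {n : ℕ} (A : Graph n) (bank : Fin n) where

  infixl 6 _⊖_

  _⊖_ : Config A → FiringVector n → Config A
  (a ⊖ x) w = a w - Q† A x w

  stable-resp : ∀ {c d} → c ≗ d → Stable A bank c → Stable A bank d
  stable-resp c≗d stable v v≢bank = subst (ℤ._< + Δ A v) (c≗d v) (stable v v≢bank)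

  ⊖-cong : ∀ a {x y} → x ≗ y → a ⊖ x ≗ a ⊖ y
  ⊖-cong a x≗y w = cong (a w -_) (Q†-cong A x≗y w)

  ⊖-0 : ∀ a → a ⊖ 0ᵛ ≗ a
  ⊖-0 a w = trans (cong (a w -_) (Q†-0 A w)) (ℤP.+-identityʳ (a w))

  ⊖-+-kernel : ∀ a x {k} → (∀ w → Q† A k w ≡ + 0) → a ⊖ (x +ᵛ k) ≗ a ⊖ x
  ⊖-+-kernel a x {k} ker w =
    cong (a w -_)
      (trans (Q†-+ A x k w) (trans (cong (ℤ._+_ (Q† A x w)) (ker w)) (ℤP.+-identityʳ _)))

  ⊖-fixed⇒kernel : ∀ a x → a ⊖ x ≗ a → ∀ w → Q† A x w ≡ + 0
  ⊖-fixed⇒kernel a x fixed w = i-j≡i⇒j≡0 (a w) (Q† A x w) (fixed w)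

  module _ (a : Config A) where

    fire-⊖ : ∀ {c x} v → c ≗ a ⊖ x → fire A c v ≗ a ⊖ (x +ᵛ χ v)
    fire-⊖ {c} {x} v c≗ w = begin
      c w - Q A v w                     ≡⟨ cong (_- Q A v w) (c≗ w) ⟩
      (a w - Q† A x w) - Q A v w        ≡⟨ regroup (a w) (Q† A x w) (Q A v w) ⟩
      a w - (Q† A x w ℤ.+ Q A v w)      ≡⟨ cong (λ q → a w - (Q† A x w ℤ.+ q)) (Q†-χ A v w) ⟨
      a w - (Q† A x w ℤ.+ Q† A (χ v) w) ≡⟨ cong (a w -_) (Q†-+ A x (χ v) w) ⟨
      a w - Q† A (x +ᵛ χ v) w           ∎
      where
      open ≡-Reasoning
      regroup : ∀ a p q → (a - p) - q ≡ a - (p ℤ.+ q)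
      regroup = solve-∀

    legal⇒fired : ∀ {c x u v} → Legal A bank c v → c ≗ a ⊖ x → x ≤ᵛ u →
      Stable A bank (a ⊖ u) → x v ℕ.< u v
    legal⇒fired {c} {x} {u} {v} (v≢bank , Δ≤cv) c≗ x≤u stable
      with ℕP.m≤n⇒m<n∨m≡n (x≤u v)
    ... | inj₁ xv<uv = xv<uv
    ... | inj₂ xv≡uv = ⊥-elim (ℤP.<-irrefl refl (ℤP.≤-<-trans Δ≤ (stable v v≢bank)))
      where
      open ℤP.≤-Reasoning
      Q†u≤Q†x : Q† A u v ℤ.≤ Q† A x v
      Q†u≤Q†x = Q†-antitone-where-equal A x≤u xv≡uv
      Δ≤ : + Δ A v ℤ.≤ (a ⊖ u) v
      Δ≤ = begin
        + Δ A v          ≤⟨ Δ≤cv ⟩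
        c v              ≡⟨ c≗ v ⟩
        a v - Q† A x v   ≤⟨ ℤP.+-monoʳ-≤ (a v) (ℤP.neg-mono-≤ Q†u≤Q†x) ⟩
        a v - Q† A u v   ∎

    record LeastAction (x₀ x : FiringVector n) : Set where
      field
        start-≤   : x₀ ≤ᵛ x
        bank-idle : x bank ≡ x₀ bank
        minimal   : ∀ u → x₀ ≤ᵛ u → Stable A bank (a ⊖ u) → x ≤ᵛ u

    open LeastAction public

    legalSeq-leastAction : ∀ {c d x₀} → LegalSeq A bank c d → c ≗ a ⊖ x₀ →
      ∃ λ x → d ≗ a ⊖ x × LeastAction x₀ x
    legalSeq-leastAction {x₀ = x₀} (done c≗d) c≗ =
      x₀ , (λ w → trans (sym (c≗d w)) (c≗ w)) ,
      record { start-≤ = λ i → ℕP.≤-refl ; bank-idle = refl ; minimal = λ u x₀≤u _ → x₀≤u }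
    legalSeq-leastAction {x₀ = x₀} (fire-step v legal rest) c≗
      with legalSeq-leastAction rest (fire-⊖ v c≗)
    ... | x , d≗ , la = x , d≗ , record
      { start-≤   = λ i → ℕP.≤-trans (ℕP.m≤m+n (x₀ i) _) (start-≤ la i)
      ; bank-idle = trans (bank-idle la)
                      (trans (cong (x₀ bank ℕ.+_) (χ-other (proj₁ legal ∘ sym)))
                             (ℕP.+-identityʳ _))
      ; minimal   = λ u x₀≤u stable →
                      minimal la u (+χ-≤ v x₀≤u (legal⇒fired legal c≗ x₀≤u stable)) stable
      }

    successor-leastAction : ∀ {c e x} → Successor A bank c e → c ≗ a ⊖ x →
      ∃ λ y → e ≗ a ⊖ y × LeastAction (x +ᵛ χ bank) y
    successor-leastAction (_ , seq , _) c≗ = legalSeq-leastAction seq (fire-⊖ bank c≗)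

  successor-unique : ∀ {c c' e e'} → c ≗ c' →
    Successor A bank c e → Successor A bank c' e' → e ≗ e'
  successor-unique {c} c≗c' s s'
    with successor-leastAction c s (sym ∘ ⊖-0 c)
       | successor-leastAction c s' (λ w → trans (sym (c≗c' w)) (sym (⊖-0 c w)))
  ... | y , e≗ , la | y' , e'≗ , la' =
    λ w → trans (e≗ w) (trans (⊖-cong c y≗y' w) (sym (e'≗ w)))
    where
    y≗y' : y ≗ y'
    y≗y' i = ℕP.≤-antisym
      (minimal la  y' (start-≤ la')  (stable-resp e'≗ (proj₂ (proj₂ s'))) i)
      (minimal la' y  (start-≤ la)   (stable-resp e≗  (proj₂ (proj₂ s))) i)

  module _ (sc : StronglyConnected A) (h : FiringVector n)
           (h-kernel : ∀ w → Q† A h w ≡ + 0) (h-bank : h bank ≡ 1) where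

    χbank≤h : χ bank ≤ᵛ h
    χbank≤h = χ-≤ bank (ℕP.≤-reflexive (sym h-bank))

    -- Firing h at once from c = a ⊖ x leads back to c, which is stable.
    successor-fires-≤h : ∀ a {c e x} → Successor A bank c e → c ≗ a ⊖ x →
      ∃ λ y → e ≗ a ⊖ y × y bank ≡ suc (x bank) × y ≤ᵛ x +ᵛ h
    successor-fires-≤h a {x = x} s c≗ with successor-leastAction a s c≗
    ... | y , e≗ , la = y , e≗ , y-bank , y≤
      where
      y-bank : y bank ≡ suc (x bank)
      y-bank =
        trans (bank-idle la) (trans (cong (x bank ℕ.+_) (χ-same bank)) (ℕP.+-comm (x bank) 1))
      y≤ : y ≤ᵛ x +ᵛ h
      y≤ = minimal la (x +ᵛ h) (λ i → ℕP.+-monoʳ-≤ (x i) (χbank≤h i))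
             (stable-resp (λ w → trans (c≗ w) (sym (⊖-+-kernel a x h-kernel w))) (proj₁ s))

    iterate-fires-≤ : ∀ a m {c d x} → Iter A bank m c d → c ≗ a ⊖ x →
      ∃ λ y → d ≗ a ⊖ y × y bank ≡ m ℕ.+ x bank × y ≤ᵛ x +ᵛ m *ᵛ h
    iterate-fires-≤ a zero {x = x} c≗d c≗ =
      x , (λ w → trans (sym (c≗d w)) (c≗ w)) , refl , (λ i → ℕP.m≤m+n (x i) 0)
    iterate-fires-≤ a (suc m) {x = x} (e , s , it) c≗
      with successor-fires-≤h a s c≗
    ... | y₁ , e≗ , y₁-bank , y₁≤ with iterate-fires-≤ a m it e≗
    ... | y , d≗ , y-bank , y≤ =
      y , d≗ , trans y-bank (trans (cong (m ℕ.+_) y₁-bank) (ℕP.+-suc m (x bank))) ,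
      λ i → begin
        y i                           ≤⟨ y≤ i ⟩
        y₁ i ℕ.+ m ℕ.* h i            ≤⟨ ℕP.+-monoˡ-≤ (m ℕ.* h i) (y₁≤ i) ⟩
        x i ℕ.+ h i ℕ.+ m ℕ.* h i     ≡⟨ ℕP.+-assoc (x i) (h i) (m ℕ.* h i) ⟩
        x i ℕ.+ (h i ℕ.+ m ℕ.* h i)   ∎
      where open ℕP.≤-Reasoning

    on-cycle⇒successor-fixed : ∀ k {a c e} → Iter A bank (suc k) a a → c ≗ a →
      Successor A bank c e → e ≗ a
    on-cycle⇒successor-fixed k {a} {e = e} (c₁ , s₁ , cycle) c≗a s
      with successor-fires-≤h a s₁ (sym ∘ ⊖-0 a)
    ... | y₁ , c₁≗ , y₁-bank , y₁≤h with iterate-fires-≤ a k cycle c₁≗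
    ... | y , a≗ , y-bank , y≤ = λ w → begin
      e w          ≡⟨ successor-unique c≗a s s₁ w ⟩
      c₁ w         ≡⟨ c₁≗ w ⟩
      (a ⊖ y₁) w   ≡⟨ ⊖-cong a y₁≗h w ⟩
      (a ⊖ h) w    ≡⟨ ⊖-+-kernel a 0ᵛ h-kernel w ⟩
      (a ⊖ 0ᵛ) w   ≡⟨ ⊖-0 a w ⟩
      a w          ∎
      where
      open ≡-Reasoning
      y≤[1+k]h : y ≤ᵛ suc k *ᵛ h
      y≤[1+k]h i = ℕP.≤-trans (y≤ i) (ℕP.+-monoˡ-≤ (k ℕ.* h i) (y₁≤h i))
      y-bank≡[1+k]h-bank : y bank ≡ suc k ℕ.* h bank
      y-bank≡[1+k]h-bank = begin
        y bank              ≡⟨ y-bank ⟩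
        k ℕ.+ y₁ bank       ≡⟨ cong (k ℕ.+_) y₁-bank ⟩
        k ℕ.+ 1             ≡⟨ ℕP.+-comm k 1 ⟩
        suc k               ≡⟨ ℕP.*-identityʳ (suc k) ⟨
        suc k ℕ.* 1         ≡⟨ cong (suc k ℕ.*_) h-bank ⟨
        suc k ℕ.* h bank    ∎
      y≗[1+k]h : y ≗ suc k *ᵛ h
      y≗[1+k]h = kernel-≤-rigid A sc y≤[1+k]h
        (λ w → trans (⊖-fixed⇒kernel a y (sym ∘ a≗) w)
                     (sym (Q†-*ᵛ-kernel A h-kernel (suc k) w)))
        y-bank≡[1+k]h-bank
      y₁≗h : y₁ ≗ h
      y₁≗h i = ℕP.≤-antisym (y₁≤h i) (ℕP.+-cancelʳ-≤ (k ℕ.* h i) (h i) (y₁ i)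
        (ℕP.≤-trans (ℕP.≤-reflexive (sym (y≗[1+k]h i))) (y≤ i)))

    on-cycle⇒coeval-equal : ∀ k m {a c b} → Iter A bank (suc k) a a → c ≗ a →
      Iter A bank m c b → a ≗ b
    on-cycle⇒coeval-equal k zero    cycle c≗a c≗b = λ w → trans (sym (c≗a w)) (c≗b w)
    on-cycle⇒coeval-equal k (suc m) cycle c≗a (e , s , it) =
      on-cycle⇒coeval-equal k m cycle (on-cycle⇒successor-fixed k cycle c≗a s) it

proposition9p7 :
    (n : ℕ) (A : Graph n) (bank : Fin n) →
    Loopless A → StronglyConnected A →
    (h : Fin n → ℕ) → IsActivity A h → h bank ≡ 1 →
    (a b : Config A) →
    IsConfiguration A a → IsConfiguration A b →
    Critical A bank a → Critical A bank b →
    Coeval A bank a b →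
    ∀ v → a v ≡ b v
proposition9p7 n A bank _ sc h (_ , _ , h-kernel) h-bank a b _ _ (_ , k , cycle) _ (m , a→b) =
  Firing.on-cycle⇒coeval-equal A bank sc h Q†h≡0 h-bank k m cycle (λ _ → refl) a→b
  where
  Q†h≡0 : ∀ w → Q† A h w ≡ + 0
  Q†h≡0 w = trans (sym (QTapply≡Q† A h w)) (h-kernel w)
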